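{- Let $b\ge3$ be odd, let $a=a(b,i)$ be an odd element of $RRS^*(b)$, and let $P=P(b)$ be the primitive period of $c_j=\mathrm{mod}^*(a2^j,b)$, $j\ge1$. - Let $MDS'(b,i)=(c'_0,c'_1,\dots,c'_{P-1})$ with $c'_0=a$ and $c'_j=c_j$ for $1\le j\le P-1$. The index of the entry $c'_j$ is $j$. - Let $co'_0,co'_1,\dots,co'_{r^*-1}$ be the odd entries of $MDS'(b,i)$ in their order of occurrence, so that $co'_0=a$, and let $\mathrm{ind}(co'_j)$ be the index of $co'_j$. - Set $l'_j=\mathrm{ind}(co'_j)-\mathrm{ind}(co'_{j-1})$ for $j=1,\dots,r^*$, with the convention $\mathrm{ind}(co'_{r^*}):=P$. Then $$co'_j=b-2^{\,l'_j}\,co'_{j-1}\qquad\text{for } j=1,\dots,r^*-1.$$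
   Context: For odd $b\ge3$: - $RRS^*(b)=\{r\in\mathbb Z:1\le r\le(b-1)/2,\ \gcd(r,b)=1\}$. - For $m$ coprime to $b$, $\mathrm{mod}^*(m,b)=\mathrm{mod}(m,b)$ if the least non-negative residue $\mathrm{mod}(m,b)$ is $\le b/2$, and $\mathrm{mod}^*(m,b)=\mathrm{mod}(-m,b)$ otherwise. - The sequence $(\mathrm{mod}^*(a2^j,b))_{j\ge1}$ is purely periodic, with $c_P=a$. - $a(b,i)$ is the $i$-th input of the complete MDS system: $a(b,1)=1$, and each further input is the smallest odd element of $RRS^*(b)$ not yet occurring in previously generated sequences. -}

module Defs where

open import Data.Nat using (ℕ; zero; suc; _+_; _*_; _∸_; _^_; _≤_; _<_; _≤?_)
open import Data.Nat.DivMod using (_%_)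
open import Data.Nat.Coprimality using (Coprime)
open import Data.Nat.Properties using (_≟_)
open import Data.List using (List; filter; upTo)
open import Data.Product using (_×_)
open import Relation.Nullary using (¬_; Dec)
open import Relation.Nullary.Decidable using (⌊_⌋)
open import Relation.Binary.PropositionalEquality using (_≡_)
open import Data.Bool using (if_then_else_)

Odd : ℕ → Set
Odd n = n % 2 ≡ 1

odd? : (n : ℕ) → Dec (Odd n)
odd? n = (n % 2) ≟ 1

-- membership in RRS*(b) = {r : 1 ≤ r ≤ (b-1)/2, gcd(r,b)=1}
-- (for odd b, r ≤ (b-1)/2 iff 2r < b)
InRRS* : ℕ → ℕ → Set
InRRS* b r = (1 ≤ r) × (2 * r < b) × Coprime r b

-- mod*(m,b): least non-negative residue r = mod(m,b) if r ≤ b/2 (i.e. 2r ≤ b),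
-- otherwise mod(-m,b) = b - r  (r ≠ 0 for m coprime to b).
modStar : ℕ → ℕ → ℕ
modStar zero m = m
modStar (suc k) m =
  if ⌊ 2 * (m % suc k) ≤? suc k ⌋ then m % suc k else suc k ∸ (m % suc k)

cSeq : ℕ → ℕ → ℕ → ℕ
cSeq b a j = modStar b (a * 2 ^ j)

IsPrimitivePeriod : (ℕ → ℕ) → ℕ → Set
IsPrimitivePeriod c P =
  (1 ≤ P) × (∀ j → 1 ≤ j → c (j + P) ≡ c j) ×
  (∀ Q → 1 ≤ Q → Q < P → ¬ (∀ j → 1 ≤ j → c (j + Q) ≡ c j))

mdsEntry : ℕ → ℕ → ℕ → ℕ
mdsEntry b a zero = a
mdsEntry b a (suc j) = cSeq b a (suc j)

-- indices (in increasing order) of the odd entries of MDS' = (c'_0,…,c'_{P-1});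
-- its length is r*, and its k-th element is ind(co'_k)
oddIndices : ℕ → ℕ → ℕ → List ℕ
oddIndices b a P = filter (λ j → odd? (mdsEntry b a j)) (upTo P)

-- Because 2a < b, each entry of MDS' is obtained from the previous one either by doubling
-- it or by replacing it with b minus its double: mod*(2m, b) is ±2 mod*(m, b) folded back
-- into [0, b/2]. As b is odd, the second alternative happens exactly when the new entry is
-- odd. Hence between two consecutive odd entries co'_{j-1}, co'_j the sequence only doubles,
-- reaching 2^(l'_j - 1) co'_{j-1} just before co'_j, and then co'_j = b - 2^(l'_j) co'_{j-1}.

module Submission where

open import Defs
open import Data.Nat using (ℕ; zero; suc; _+_; _*_; _∸_; _^_; _≤_; _<_; _≤?_; NonZero; s<s⁻¹)
open import Data.Nat.Properties
open import Data.Nat.DivMod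
open import Data.Nat.Tactic.RingSolver using (solve-∀)
open import Data.Sum as Sum using (_⊎_; inj₁; inj₂)
open import Data.Product using (∃-syntax; ∃₂; _×_; _,_; proj₂)
open import Data.List using (length; lookup; filter; applyUpTo)
open import Data.Fin using (fromℕ<)
open import Relation.Nullary using (¬_; yes; no; contradiction)
open import Relation.Unary using (Pred; Decidable)
open import Relation.Binary.PropositionalEquality
open import Function using (_∘_; id)
open import Algebra.Properties.CommutativeSemigroup *-commutativeSemigroup using (x∙yz≈y∙xz)

module _ {a p} {A : Set a} {P : Pred A p} (P? : Decidable P) where

  first-in-filter-applyUpTo : ∀ f n (h : 0 < length (filter P? (applyUpTo f n))) →
    ∃[ v ] lookup (filter P? (applyUpTo f n)) (fromℕ< h) ≡ f v × P (f v)
      × (∀ w → w < v → ¬ P (f w))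
  first-in-filter-applyUpTo f (suc n) h with P? (f zero)
  ... | yes p₀ = zero , refl , p₀ , λ _ ()
  ... | no ¬p with first-in-filter-applyUpTo (f ∘ suc) n h
  ...   | v , eq , pv , before = suc v , eq , pv , λ where
            zero    _   → ¬p
            (suc w) w<v → before w (s<s⁻¹ w<v)

  consecutive-in-filter-applyUpTo : ∀ f n j
    (h : suc j < length (filter P? (applyUpTo f n))) (h′ : j < length (filter P? (applyUpTo f n))) →
    ∃₂ λ u d → lookup (filter P? (applyUpTo f n)) (fromℕ< h′) ≡ f u
      × lookup (filter P? (applyUpTo f n)) (fromℕ< h) ≡ f (u + suc d)
      × P (f (u + suc d)) × (∀ s → s < d → ¬ P (f (u + suc s)))
  consecutive-in-filter-applyUpTo f (suc n) j h h′ with P? (f zero)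
  consecutive-in-filter-applyUpTo f (suc n) j h h′ | no _
    with consecutive-in-filter-applyUpTo (f ∘ suc) n j h h′
  ... | u , d , eq , eq′ , pd , gap = suc u , d , eq , eq′ , pd , gap
  consecutive-in-filter-applyUpTo f (suc n) zero h h′ | yes _
    with first-in-filter-applyUpTo (f ∘ suc) n (s<s⁻¹ h)
  ... | v , eq , pv , before = zero , v , refl , eq , pv , before
  consecutive-in-filter-applyUpTo f (suc n) (suc j) h h′ | yes _
    with consecutive-in-filter-applyUpTo (f ∘ suc) n j (s<s⁻¹ h) (s<s⁻¹ h′)
  ... | u , d , eq , eq′ , pd , gap = suc u , d , eq , eq′ , pd , gap

-- y = 2x or y = b − 2x, stated without truncated subtraction.
data ±Double (b x y : ℕ) : Set where
  double  : y ≡ 2 * x → ±Double b x y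
  reflect : y + 2 * x ≡ b → ±Double b x y

¬Odd[2*x] : ∀ x → ¬ Odd (2 * x)
¬Odd[2*x] x odd = 0≢1+n (begin
  0             ≡⟨ sym (m*n%n≡0 x 2) ⟩
  (x * 2) % 2   ≡⟨ cong (_% 2) (*-comm x 2) ⟩
  (2 * x) % 2   ≡⟨ odd ⟩
  1             ∎)
  where open ≡-Reasoning

Odd[y+2*x]⇒Odd[y] : ∀ y x → Odd (y + 2 * x) → Odd y
Odd[y+2*x]⇒Odd[y] y x odd = begin
  y % 2             ≡⟨ sym ([m+kn]%n≡m%n y x 2) ⟩
  (y + x * 2) % 2   ≡⟨ cong (λ z → (y + z) % 2) (*-comm x 2) ⟩
  (y + 2 * x) % 2   ≡⟨ odd ⟩
  1                 ∎
  where open ≡-Reasoning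

±Double-odd : ∀ {b x y} → Odd b → ±Double b x y → Odd y → y + 2 * x ≡ b
±Double-odd {x = x} _ (double refl) odd = contradiction odd (¬Odd[2*x] x)
±Double-odd _ (reflect eq) _ = eq

±Double-even : ∀ {b x y} → Odd b → ±Double b x y → ¬ Odd y → y ≡ 2 * x
±Double-even _ (double eq) _ = eq
±Double-even {x = x} {y} b-odd (reflect refl) ¬odd = contradiction (Odd[y+2*x]⇒Odd[y] y x b-odd) ¬odd

±Double-fold : ∀ {b x y z} → y < b → ±Double b x y → z ≡ y ⊎ z ≡ b ∸ y → ±Double b x z
±Double-fold _ d (inj₁ refl) = d
±Double-fold y<b (double refl) (inj₂ refl) = reflect (m∸n+n≡m (<⇒≤ y<b))
±Double-fold {x = x} {y} _ (reflect refl) (inj₂ refl) = double (m+n∸m≡n y (2 * x))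

%-double : ∀ m B .{{_ : NonZero B}} → (2 * m) % B ≡ (2 * (m % B)) % B
%-double m B = begin
  (2 * m) % B            ≡⟨ cong (λ z → (m + z) % B) (+-identityʳ m) ⟩
  (m + m) % B            ≡⟨ %-distribˡ-+ m m B ⟩
  (m % B + m % B) % B    ≡⟨ cong (λ z → (m % B + z) % B) (sym (+-identityʳ (m % B))) ⟩
  (2 * (m % B)) % B      ∎
  where open ≡-Reasoning

±Double-%-small : ∀ {B r} .{{_ : NonZero B}} → 2 * r ≤ B → ±Double B r ((2 * r) % B)
±Double-%-small {B} {r} 2r≤B with m≤n⇒m<n∨m≡n 2r≤B
... | inj₁ 2r<B = double (m<n⇒m%n≡m 2r<B)
... | inj₂ 2r≡B = reflect (begin
  (2 * r) % B + 2 * r   ≡⟨ cong (λ z → z % B + z) 2r≡B ⟩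
  B % B + B             ≡⟨ cong (_+ B) (n%n≡0 B) ⟩
  B                     ∎)
  where open ≡-Reasoning

reflect-double : ∀ {B r y} → r ≤ B → y + B ≡ 2 * r → y + 2 * (B ∸ r) ≡ B
reflect-double {B} {r} {y} r≤B y+B≡2r = +-cancelʳ-≡ B (y + 2 * t) B (begin
  y + 2 * t + B     ≡⟨ rearrange y t B ⟩
  (y + B) + 2 * t   ≡⟨ cong (_+ 2 * t) y+B≡2r ⟩
  2 * r + 2 * t     ≡⟨ sym (*-distribˡ-+ 2 r t) ⟩
  2 * (r + t)       ≡⟨ cong (2 *_) (m+[n∸m]≡n r≤B) ⟩
  B + (B + 0)       ≡⟨ cong (B +_) (+-identityʳ B) ⟩
  B + B             ∎)
  where
  open ≡-Reasoning
  t = B ∸ r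
  rearrange : ∀ y t B → y + 2 * t + B ≡ (y + B) + 2 * t
  rearrange = solve-∀

±Double-%-large : ∀ {B r} .{{_ : NonZero B}} → r < B → B < 2 * r → ±Double B (B ∸ r) ((2 * r) % B)
±Double-%-large {B} {r} r<B B<2r = reflect (subst (λ z → z + 2 * (B ∸ r) ≡ B) (sym 2r%B≡y) y+2t≡B)
  where
  y = 2 * r ∸ B
  y+2t≡B : y + 2 * (B ∸ r) ≡ B
  y+2t≡B = reflect-double (<⇒≤ r<B) (m∸n+n≡m (<⇒≤ B<2r))
  y<B : y < B
  y<B = subst (y <_) y+2t≡B (m<m+n y (*-monoʳ-< 2 (m<n⇒0<n∸m r<B)))
  2r%B≡y : (2 * r) % B ≡ y
  2r%B≡y = trans (sym (m≤n⇒[n∸m]%m≡n%m (<⇒≤ B<2r))) (m<n⇒m%n≡m y<B)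

modStar-view : ∀ k m →
  (2 * (m % suc k) ≤ suc k × modStar (suc k) m ≡ m % suc k)
  ⊎ (suc k < 2 * (m % suc k) × modStar (suc k) m ≡ suc k ∸ m % suc k)
modStar-view k m with 2 * (m % suc k) ≤? suc k
... | yes le = inj₁ (le , refl)
... | no ¬le = inj₂ (≰⇒> ¬le , refl)

modStar-small : ∀ k m → 2 * m < suc k → modStar (suc k) m ≡ m
modStar-small k m 2m<b with modStar-view k m | m<n⇒m%n≡m (≤-<-trans (m≤m+n m (m + 0)) 2m<b)
... | inj₁ (_ , eq)   | m%b≡m = trans eq m%b≡m
... | inj₂ (b<2r , _) | m%b≡m =
  contradiction 2m<b (<-asym (subst (λ r → suc k < 2 * r) m%b≡m b<2r))

±Double-%-modStar : ∀ k m → ±Double (suc k) (modStar (suc k) m) ((2 * m) % suc k)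
±Double-%-modStar k m rewrite %-double m (suc k) ⦃ _ ⦄ with modStar-view k m
... | inj₁ (2r≤b , eq) rewrite eq = ±Double-%-small 2r≤b
... | inj₂ (b<2r , eq) rewrite eq = ±Double-%-large (m%n<n m (suc k)) b<2r

modStar-double : ∀ k m → ±Double (suc k) (modStar (suc k) m) (modStar (suc k) (2 * m))
modStar-double k m = ±Double-fold (m%n<n (2 * m) (suc k)) (±Double-%-modStar k m)
  (Sum.map proj₂ proj₂ (modStar-view k (2 * m)))

cSeq-step : ∀ k a j → ±Double (suc k) (cSeq (suc k) a j) (cSeq (suc k) a (suc j))
cSeq-step k a j = subst (±Double (suc k) (cSeq (suc k) a j) ∘ modStar (suc k))
  (sym (x∙yz≈y∙xz a 2 (2 ^ j))) (modStar-double k (a * 2 ^ j))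

mdsEntry≡cSeq : ∀ k a → 2 * a < suc k → ∀ j → mdsEntry (suc k) a j ≡ cSeq (suc k) a j
mdsEntry≡cSeq k a 2a<b zero    =
  sym (trans (cong (modStar (suc k)) (*-identityʳ a)) (modStar-small k a 2a<b))
mdsEntry≡cSeq k a 2a<b (suc j) = refl

mdsEntry-step : ∀ k a → 2 * a < suc k →
  ∀ j → ±Double (suc k) (mdsEntry (suc k) a j) (mdsEntry (suc k) a (suc j))
mdsEntry-step k a 2a<b j = subst (λ x → ±Double (suc k) x (cSeq (suc k) a (suc j)))
  (sym (mdsEntry≡cSeq k a 2a<b j)) (cSeq-step k a j)

module DoublingChain {b} (b-odd : Odd b) (e : ℕ → ℕ)
  (step : ∀ j → ±Double b (e j) (e (suc j))) where

  doubles-while-even : ∀ u t → (∀ s → s < t → ¬ Odd (e (u + suc s))) → e (u + t) ≡ 2 ^ t * e u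
  doubles-while-even u zero _ = trans (cong e (+-identityʳ u)) (sym (*-identityˡ (e u)))
  doubles-while-even u (suc t) even = begin
    e (u + suc t)      ≡⟨ cong e (+-suc u t) ⟩
    e (suc (u + t))    ≡⟨ ±Double-even b-odd (step (u + t)) (subst (¬_ ∘ Odd ∘ e) (+-suc u t) (even t (n<1+n t))) ⟩
    2 * e (u + t)      ≡⟨ cong (2 *_) (doubles-while-even u t (λ s s<t → even s (m<n⇒m<1+n s<t))) ⟩
    2 * (2 ^ t * e u)  ≡⟨ sym (*-assoc 2 (2 ^ t) (e u)) ⟩
    2 ^ suc t * e u    ∎
    where open ≡-Reasoning

  odd-after-even-run : ∀ u d → (∀ s → s < d → ¬ Odd (e (u + suc s))) → Odd (e (u + suc d)) →
    e (u + suc d) + 2 ^ suc d * e u ≡ b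
  odd-after-even-run u d even odd = begin
    e (u + suc d) + 2 ^ suc d * e u    ≡⟨ cong (e (u + suc d) +_) (*-assoc 2 (2 ^ d) (e u)) ⟩
    e (u + suc d) + 2 * (2 ^ d * e u)  ≡⟨ cong (λ z → e (u + suc d) + 2 * z) (sym (doubles-while-even u d even)) ⟩
    e (u + suc d) + 2 * e (u + d)      ≡⟨ ±Double-odd b-odd last-step odd ⟩
    b                                  ∎
    where
    open ≡-Reasoning
    last-step : ±Double b (e (u + d)) (e (u + suc d))
    last-step = subst (±Double b (e (u + d)) ∘ e) (sym (+-suc u d)) (step (u + d))

lemma23 : (b a P : ℕ) → 3 ≤ b → Odd b → InRRS* b a → Odd a →
    IsPrimitivePeriod (cSeq b a) P →
    (j : ℕ) → (h : suc j < length (oddIndices b a P)) →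
    mdsEntry b a (lookup (oddIndices b a P) (fromℕ< h))
      + 2 ^ (lookup (oddIndices b a P) (fromℕ< h)
              ∸ lookup (oddIndices b a P) (fromℕ< (<-trans (n<1+n j) h)))
        * mdsEntry b a (lookup (oddIndices b a P) (fromℕ< (<-trans (n<1+n j) h)))
      ≡ b
lemma23 (suc k) a P _ b-odd (_ , 2a<b , _) _ _ j h
  with consecutive-in-filter-applyUpTo (odd? ∘ mdsEntry (suc k) a) id P j h (<-trans (n<1+n j) h)
... | u , d , eq , eq′ , odd , even rewrite eq | eq′ | m+n∸m≡n u (suc d) =
  DoublingChain.odd-after-even-run b-odd (mdsEntry (suc k) a) (mdsEntry-step k a 2a<b) u d even odd
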